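{- Let $\Theta$ be a saturated branch of a tableau of $\mathbf{TAB}_{\mathbf{IB}}$ and let $i$ be a quasi-urfather on $\Theta$. If $i\prec_\Theta j$, then $j\in\mathrm{dom}(v_\Theta)$.
   Context: Hybrid language: fix disjoint countably infinite sets $\mathbf{Prop}$ (propositional variables) and $\mathbf{Nom}$ (nominals). Formulas: $\varphi ::= p \mid i \mid \neg\varphi \mid \varphi\land\varphi \mid \diamondsuit\varphi \mid @_i\varphi$ with $p\in\mathbf{Prop}$, $i\in\mathbf{Nom}$; $\square\varphi$ abbreviates $\neg\diamondsuit\neg\varphi$. Tableaux of $\mathbf{TAB}_{\mathbf{IB}}$: a tableau is a well-founded tree of formulas of the form $@_i\varphi$, started from a root formula $@_i\varphi$ where $i$ does not occur in $\varphi$. Each branch (maximal path) is extended by applying the rules below as often as possible, except that nothing more is added to a branch once it is closed, or once every formula that any rule could generate already occurs on it. A branch $\Theta$ is closed if $@_i\varphi, @_i\neg\varphi\in\Theta$ for some $i,\varphi$, and is saturated if every formula that any rule could generate from it already occurs in $\Theta$. Rules (premises already on the branch, conclusions added to it): [$\neg\neg$] from $@_i\neg\neg\varphi$ add $@_i\varphi$; [$\land$] from $@_i(\varphi\land\psi)$ add $@_i\varphi$ and $@_i\psi$; [$\neg\land$] from $@_i\neg(\varphi\land\psi)$ split the branch into one branch with $@_i\neg\varphi$ and one with $@_i\neg\psi$; [$\diamondsuit$] from $@_i\diamondsuit\varphi$ add $@_i\diamondsuit j$ and $@_j\varphi$, where $j$ is a nominal not yet occurring on the branch, the rule is applied at most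 once per formula, the premise is not an accessibility formula, and (restriction $\mathcal{D}$) $i$ is a quasi-urfather on the branch; [$\neg\diamondsuit$] from $@_i\neg\diamondsuit\varphi$ and $@_i\diamondsuit j$ add $@_j\neg\varphi$; [$@$] from $@_i@_j\varphi$ add $@_j\varphi$; [$\neg@$] from $@_i\neg@_j\varphi$ add $@_j\neg\varphi$; [$\mathit{Id}$] from $@_i\varphi$ and $@_i j$ add $@_j\varphi$, provided $@_i\varphi$ is not an accessibility formula; [$\mathit{Ref}$] add $@_i i$ for any nominal $i$ occurring on the branch; [$\square_{\mathit{sym}}$] from $@_i\square\varphi$ and $@_j\diamondsuit i$ add $@_j\varphi$; ($\mathcal{I}$) for every nominal $i$ occurring on the branch add $@_i\neg\diamondsuit i$. An accessibility formula is a formula $@_i\diamondsuit j$ added by [$\diamondsuit$] with $j$ new. Auxiliary notions for a branch $\Theta$: $@_i\varphi$ is a quasi-subformula of $@_j\psi$ if $\varphi$ is a subformula of $\psi$, or $\varphi=\neg\chi$ with $\chi$ a subformula of $\psi$. $T^\Theta(i)=\{\varphi \mid @_i\varphi\in\Theta$ and $@_i\varphi$ is a quasi-subformula of the root formula$\}$. Nominals $i,j$ are twins in $\Theta$ if $T^\Theta(i)=T^\Theta(j)$. $i\prec_\Theta j$ if $j$ was introduced by applying [$\diamondsuit$] to a formula $@_i\diamondsuit\varphi$; $\prec_\Theta^*$ is its reflexive transitive closure. A nominal $i$ is a quasi-urfather on $\Theta$ if there are no twins $j\neq k$ with $j\prec_\Theta^* i$ and $k\prec_\Theta^* i$. The identity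 urfather $v_\Theta(i)$ of a nominal $i$ occurring in $\Theta$ is the earliest introduced nominal $j$ on $\Theta$ that is a twin of $i$ and a quasi-urfather on $\Theta$, if such $j$ exists; $\mathrm{dom}(v_\Theta)$ is the set of nominals $i$ for which $v_\Theta(i)$ exists. -}

module Defs where

open import Data.Nat using (ℕ)
open import Data.List using (List; []; _∷_; [_]; _++_)
open import Data.List.Relation.Unary.Any using (Any)
open import Data.List.Relation.Unary.All using (All)
open import Data.List.Membership.Propositional using (_∈_)
open import Data.Product using (_×_; ∃; ∃₂)
open import Data.Sum using (_⊎_)
open import Relation.Nullary using (¬_)
open import Relation.Binary.PropositionalEquality using (_≡_; _≢_)
open import Relation.Binary.Construct.Closure.ReflexiveTransitive using (Star)

Nom : Set
Nom = ℕ

data Fm : Set where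
  prop : ℕ → Fm
  nom  : Nom → Fm
  neg  : Fm → Fm
  conj : Fm → Fm → Fm
  dia  : Fm → Fm
  at   : Nom → Fm → Fm

box : Fm → Fm
box φ = neg (dia (neg φ))

data Sub (φ : Fm) : Fm → Set where
  sub-refl  : Sub φ φ
  sub-neg   : ∀ {ψ} → Sub φ ψ → Sub φ (neg ψ)
  sub-conjˡ : ∀ {ψ χ} → Sub φ ψ → Sub φ (conj ψ χ)
  sub-conjʳ : ∀ {ψ χ} → Sub φ χ → Sub φ (conj ψ χ)
  sub-dia   : ∀ {ψ} → Sub φ ψ → Sub φ (dia ψ)
  sub-at    : ∀ {k ψ} → Sub φ ψ → Sub φ (at k ψ)

data NomIn (i : Nom) : Fm → Set where
  in-nom   : NomIn i (nom i)
  in-at    : ∀ {φ} → NomIn i (at i φ)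
  in-neg   : ∀ {φ} → NomIn i φ → NomIn i (neg φ)
  in-conjˡ : ∀ {φ ψ} → NomIn i φ → NomIn i (conj φ ψ)
  in-conjʳ : ∀ {φ ψ} → NomIn i ψ → NomIn i (conj φ ψ)
  in-dia   : ∀ {φ} → NomIn i φ → NomIn i (dia φ)
  in-atᵗ   : ∀ {k φ} → NomIn i φ → NomIn i (at k φ)

-- Every node of a tableau is a formula @_i φ.  An entry records i, φ and
-- whether this occurrence is an accessibility formula @_i◇j produced by the
-- rule [◇] applied to the premise @_i◇φ (tag 'acc φ'), or not (tag 'ord').
data Tag : Set where
  ord : Tag
  acc : Fm → Tag

record Entry : Set where
  constructor ent
  field
    nm  : Nom
    fm  : Fm
    tag : Tag
open Entry public

-- A branch: the list of its nodes, in the order in which they were added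
-- (root first).
Branch : Set
Branch = List Entry

Has : Branch → Nom → Fm → Set
Has Θ i φ = Any (λ e → nm e ≡ i × fm e ≡ φ) Θ

Occurs : Nom → Branch → Set
Occurs i Θ = Any (λ e → i ≡ nm e ⊎ NomIn i (fm e)) Θ

Closed : Branch → Set
Closed Θ = ∃₂ λ i φ → Has Θ i φ × Has Θ i (neg φ)

-- i ≺_Θ j : j was introduced by applying [◇] to some @_i◇φ
Prec : Branch → Nom → Nom → Set
Prec Θ i j = ∃ λ φ → ent i (dia (nom j)) (acc φ) ∈ Θ

Prec* : Branch → Nom → Nom → Set
Prec* Θ = Star (Prec Θ)

QSubRoot : Fm → Fm → Set
QSubRoot φ0 φ = Sub φ φ0 ⊎ ∃ λ χ → φ ≡ neg χ × Sub χ φ0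

InT : Fm → Branch → Nom → Fm → Set
InT φ0 Θ i φ = Has Θ i φ × QSubRoot φ0 φ

Twins : Fm → Branch → Nom → Nom → Set
Twins φ0 Θ i j = ∀ φ → (InT φ0 Θ i φ → InT φ0 Θ j φ) × (InT φ0 Θ j φ → InT φ0 Θ i φ)

QuasiUrfather : Fm → Branch → Nom → Set
QuasiUrfather φ0 Θ i =
  ∀ j k → j ≢ k → Prec* Θ j i → Prec* Θ k i → ¬ Twins φ0 Θ j k

-- Rule applications on Θ.  An application yields a list of alternatives
-- (one per resulting branch); each alternative is the list of nodes added.
data App (φ0 : Fm) (Θ : Branch) : List (List Entry) → Set where
  r-negneg  : ∀ {i φ} → Has Θ i (neg (neg φ)) → App φ0 Θ [ [ ent i φ ord ] ]
  r-conj    : ∀ {i φ ψ} → Has Θ i (conj φ ψ) →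
              App φ0 Θ [ ent i φ ord ∷ ent i ψ ord ∷ [] ]
  r-negconj : ∀ {i φ ψ} → Has Θ i (neg (conj φ ψ)) →
              App φ0 Θ ([ ent i (neg φ) ord ] ∷ [ ent i (neg ψ) ord ] ∷ [])
  -- [◇]: premise is a non-accessibility occurrence of @_i◇φ, the rule has not
  -- yet been applied to it, i is a quasi-urfather (restriction D), j is new.
  r-dia     : ∀ {i φ j} → ent i (dia φ) ord ∈ Θ →
              (∀ k → ¬ (ent i (dia (nom k)) (acc φ) ∈ Θ)) →
              QuasiUrfather φ0 Θ i → ¬ Occurs j Θ →
              App φ0 Θ [ ent i (dia (nom j)) (acc φ) ∷ ent j φ ord ∷ [] ]
  r-negdia  : ∀ {i φ j} → Has Θ i (neg (dia φ)) → Has Θ i (dia (nom j)) →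
              App φ0 Θ [ [ ent j (neg φ) ord ] ]
  r-at      : ∀ {i j φ} → Has Θ i (at j φ) → App φ0 Θ [ [ ent j φ ord ] ]
  r-negat   : ∀ {i j φ} → Has Θ i (neg (at j φ)) →
              App φ0 Θ [ [ ent j (neg φ) ord ] ]
  r-id      : ∀ {i j φ} → ent i φ ord ∈ Θ → Has Θ i (nom j) →
              App φ0 Θ [ [ ent j φ ord ] ]
  r-ref     : ∀ {i} → Occurs i Θ → App φ0 Θ [ [ ent i (nom i) ord ] ]
  r-boxsym  : ∀ {i j φ} → Has Θ i (box φ) → Has Θ j (dia (nom i)) →
              App φ0 Θ [ [ ent j φ ord ] ]
  r-irr     : ∀ {i} → Occurs i Θ →
              App φ0 Θ [ [ ent i (neg (dia (nom i))) ord ] ]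

-- Saturated: for every possible rule application, the formulas of (one of)
-- its alternatives already occur on Θ.  (For [◇] this can never hold, since
-- the conclusion mentions a new nominal; so saturation means [◇] is not
-- applicable.)
Saturated : Fm → Branch → Set
Saturated φ0 Θ =
  ∀ alts → App φ0 Θ alts → Any (All (λ e → Has Θ (nm e) (fm e))) alts

-- Θ is (a root-to-current-node path of) a branch of a TAB_IB tableau with
-- root formula @_r φ0 : nodes are added only by rule applications, and
-- nothing is added once the branch is closed or saturated.
data TabBranch (r : Nom) (φ0 : Fm) : Branch → Set where
  root   : ¬ NomIn r φ0 → TabBranch r φ0 [ ent r φ0 ord ]
  extend : ∀ {Θ alts Δ} → TabBranch r φ0 Θ → ¬ Closed Θ →
           ¬ Saturated φ0 Θ → App φ0 Θ alts → Δ ∈ alts →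
           TabBranch r φ0 (Θ ++ Δ)

-- j was introduced no later than k on Θ: every initial segment of Θ in
-- which k occurs also contains j.
IntroNoLater : Branch → Nom → Nom → Set
IntroNoLater Θ j k = ∀ Δ Γ → Θ ≡ Δ ++ Γ → Occurs k Δ → Occurs j Δ

IdUrfather : Fm → Branch → Nom → Nom → Set
IdUrfather φ0 Θ i j =
  Occurs j Θ × Twins φ0 Θ i j × QuasiUrfather φ0 Θ j ×
  (∀ k → Occurs k Θ → Twins φ0 Θ i k → QuasiUrfather φ0 Θ k →
     IntroNoLater Θ j k)

InDomV : Fm → Branch → Nom → Set
InDomV φ0 Θ i = Occurs i Θ × ∃ λ j → IdUrfather φ0 Θ i j

{-# OPTIONS --safe #-}
-- Every nominal is introduced by [◇] at most once, so i is the only ≺-parent of j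
-- and every ≺*-ancestor of j other than j is a ≺*-ancestor of i.  Two distinct
-- twins below j cannot both lie below the quasi-urfather i, so one of them is j
-- and the other an ancestor k of i; ancestors of quasi-urfathers are
-- quasi-urfathers.  Hence j has a twin that is a quasi-urfather: j itself, or k.
-- Being twins and being a quasi-urfather are decidable on a finite branch, so the
-- earliest introduced such twin exists, and it is v_Θ(j).
module Submission where

open import Defs
open import Data.Nat using (ℕ; _≟_)
open import Data.Maybe using (Maybe; just; nothing)
open import Data.List using (List; []; _∷_; _++_; map)
open import Data.List.Relation.Unary.Any as Any using (here; there; any?)
open import Data.List.Relation.Unary.All as All using (All; []; _∷_; all?)
open import Data.List.Membership.Propositional using (_∈_; find; lose)
open import Data.List.Membership.Propositional.Properties using (∈-++⁻; ∈-map⁺)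
open import Data.Product using (_×_; _,_; proj₁; proj₂; ∃; ∃₂)
open import Data.Sum using (_⊎_; inj₁; inj₂; [_,_])
open import Data.Empty using (⊥-elim)
open import Function using (id; _∘_)
open import Relation.Nullary using (¬_; Dec; yes; no)
open import Relation.Nullary.Decidable using (map′; ¬?; _×-dec_; _⊎-dec_; _→-dec_)
open import Relation.Unary using (Decidable)
open import Relation.Binary.Definitions using (DecidableEquality)
open import Relation.Binary.PropositionalEquality using (_≡_; _≢_; refl; sym; trans; cong)
open import Relation.Binary.Construct.Closure.ReflexiveTransitive using (Star; ε; _◅_; _◅◅_; gmap)

shape : Fm → ℕ
shape (prop _)   = 0
shape (nom _)    = 1
shape (neg _)    = 2
shape (conj _ _) = 3
shape (dia _)    = 4
shape (at _ _)   = 5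

infix 4 _≟ᶠ_

_≟ᶠ_ : DecidableEquality Fm

-- Comparing shapes first leaves only the six same-constructor cases.
≟ᶠ-sameShape : ∀ φ ψ → shape φ ≡ shape ψ → Dec (φ ≡ ψ)
≟ᶠ-sameShape (prop m)   (prop n)     refl = map′ (cong prop) (λ { refl → refl }) (m ≟ n)
≟ᶠ-sameShape (nom m)    (nom n)      refl = map′ (cong nom) (λ { refl → refl }) (m ≟ n)
≟ᶠ-sameShape (neg φ)    (neg ψ)      refl = map′ (cong neg) (λ { refl → refl }) (φ ≟ᶠ ψ)
≟ᶠ-sameShape (conj φ χ) (conj ψ ω)   refl =
  map′ (λ { (refl , refl) → refl }) (λ { refl → refl , refl }) (φ ≟ᶠ ψ ×-dec χ ≟ᶠ ω)
≟ᶠ-sameShape (dia φ)    (dia ψ)      refl = map′ (cong dia) (λ { refl → refl }) (φ ≟ᶠ ψ)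
≟ᶠ-sameShape (at m φ)   (at n ψ)     refl =
  map′ (λ { (refl , refl) → refl }) (λ { refl → refl , refl }) (m ≟ n ×-dec φ ≟ᶠ ψ)

φ ≟ᶠ ψ with shape φ ≟ shape ψ
... | yes same = ≟ᶠ-sameShape φ ψ same
... | no  diff = no (diff ∘ cong shape)

sub? : ∀ φ ψ → Dec (Sub φ ψ)
sub? φ ψ with φ ≟ᶠ ψ
... | yes refl = yes sub-refl
sub? φ (prop n)   | no φ≢ψ = no λ { sub-refl → φ≢ψ refl }
sub? φ (nom n)    | no φ≢ψ = no λ { sub-refl → φ≢ψ refl }
sub? φ (neg ψ)    | no φ≢ψ =
  map′ sub-neg (λ { sub-refl → ⊥-elim (φ≢ψ refl) ; (sub-neg s) → s }) (sub? φ ψ)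
sub? φ (conj ψ χ) | no φ≢ψ =
  map′ [ sub-conjˡ , sub-conjʳ ]
       (λ { sub-refl → ⊥-elim (φ≢ψ refl) ; (sub-conjˡ s) → inj₁ s ; (sub-conjʳ s) → inj₂ s })
       (sub? φ ψ ⊎-dec sub? φ χ)
sub? φ (dia ψ)    | no φ≢ψ =
  map′ sub-dia (λ { sub-refl → ⊥-elim (φ≢ψ refl) ; (sub-dia s) → s }) (sub? φ ψ)
sub? φ (at k ψ)   | no φ≢ψ =
  map′ sub-at (λ { sub-refl → ⊥-elim (φ≢ψ refl) ; (sub-at s) → s }) (sub? φ ψ)

negatedSub? : ∀ φ0 φ → Dec (∃ λ χ → φ ≡ neg χ × Sub χ φ0)
negatedSub? φ0 (neg χ)    = map′ (λ s → χ , refl , s) (λ { (_ , refl , s) → s }) (sub? χ φ0)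
negatedSub? φ0 (prop _)   = no λ { (_ , () , _) }
negatedSub? φ0 (nom _)    = no λ { (_ , () , _) }
negatedSub? φ0 (conj _ _) = no λ { (_ , () , _) }
negatedSub? φ0 (dia _)    = no λ { (_ , () , _) }
negatedSub? φ0 (at _ _)   = no λ { (_ , () , _) }

quasiSub? : ∀ φ0 φ → Dec (QSubRoot φ0 φ)
quasiSub? φ0 φ = sub? φ φ0 ⊎-dec negatedSub? φ0 φ

has? : ∀ Θ i φ → Dec (Has Θ i φ)
has? Θ i φ = any? (λ e → nm e ≟ i ×-dec fm e ≟ᶠ φ) Θ

has-entry : ∀ {Θ e} → e ∈ Θ → Has Θ (nm e) (fm e)
has-entry = Any.map λ { refl → refl , refl }

T⊆ : Fm → Branch → Nom → Nom → Set
T⊆ φ0 Θ a b = ∀ φ → InT φ0 Θ a φ → InT φ0 Θ b φ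

EntrywiseT⊆ : Fm → Branch → Nom → Nom → Set
EntrywiseT⊆ φ0 Θ a b = All (λ e → nm e ≡ a → QSubRoot φ0 (fm e) → Has Θ b (fm e)) Θ

entrywiseT⊆⇒T⊆ : ∀ {φ0 Θ a b} → EntrywiseT⊆ φ0 Θ a b → T⊆ φ0 Θ a b
entrywiseT⊆⇒T⊆ a⊆b φ (a∋φ , q) with find a∋φ
... | _ , e∈Θ , refl , refl = All.lookup a⊆b e∈Θ refl q , q

T⊆⇒entrywiseT⊆ : ∀ {φ0 Θ a b} → T⊆ φ0 Θ a b → EntrywiseT⊆ φ0 Θ a b
T⊆⇒entrywiseT⊆ a⊆b = All.tabulate λ {e} e∈Θ → λ { refl q → proj₁ (a⊆b (fm e) (has-entry e∈Θ , q)) }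

T⊆? : ∀ φ0 Θ a b → Dec (T⊆ φ0 Θ a b)
T⊆? φ0 Θ a b =
  map′ entrywiseT⊆⇒T⊆ T⊆⇒entrywiseT⊆
       (all? (λ e → nm e ≟ a →-dec quasiSub? φ0 (fm e) →-dec has? Θ b (fm e)) Θ)

twins? : ∀ φ0 Θ a b → Dec (Twins φ0 Θ a b)
twins? φ0 Θ a b =
  map′ (λ (a⊆b , b⊆a) φ → a⊆b φ , b⊆a φ) (λ a~b → proj₁ ∘ a~b , proj₂ ∘ a~b)
       (T⊆? φ0 Θ a b ×-dec T⊆? φ0 Θ b a)

twins-refl : ∀ {φ0 Θ a} → Twins φ0 Θ a a
twins-refl φ = id , id

twins-sym : ∀ {φ0 Θ a b} → Twins φ0 Θ a b → Twins φ0 Θ b a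
twins-sym a~b φ = proj₂ (a~b φ) , proj₁ (a~b φ)

IsEdge : Entry → Nom → Nom → Set
IsEdge e a b = ∃ λ φ → ent a (dia (nom b)) (acc φ) ≡ e

endpoints : Entry → Maybe (Nom × Nom)
endpoints (ent a (dia (nom b)) (acc _)) = just (a , b)
endpoints _                             = nothing

endpoints-sound : ∀ e {a b} → endpoints e ≡ just (a , b) → IsEdge e a b
endpoints-sound (ent a (dia (nom b)) (acc φ)) refl = φ , refl

endpoints-complete : ∀ {e a b} → IsEdge e a b → endpoints e ≡ just (a , b)
endpoints-complete (_ , refl) = refl

edge? : ∀ e → Dec (∃₂ (IsEdge e))
edge? e with endpoints e in eq
... | just (a , b) = yes (a , b , endpoints-sound e eq)
... | nothing      = no λ (_ , _ , ab) → nothing≢just (trans (sym eq) (endpoints-complete ab))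
  where
  nothing≢just : ∀ {x : Nom × Nom} → nothing ≢ just x
  nothing≢just ()

edge-unique : ∀ {e a b c d} → IsEdge e a b → IsEdge e c d → a ≡ c × b ≡ d
edge-unique (_ , refl) (_ , refl) = refl , refl

prec-∷⁻ : ∀ {e Θ a b} → Prec (e ∷ Θ) a b → IsEdge e a b ⊎ Prec Θ a b
prec-∷⁻ (φ , here ab) = inj₁ (φ , ab)
prec-∷⁻ (φ , there ab) = inj₂ (φ , ab)

prec*-∷⁺ : ∀ {e Θ a b} → Prec* Θ a b → Star (Prec (e ∷ Θ)) a b
prec*-∷⁺ = gmap id λ (φ , ab) → φ , there ab

prec*-∷-edge⁻ : ∀ {e Θ u v a b} → IsEdge e u v → Star (Prec (e ∷ Θ)) a b →
                Prec* Θ a b ⊎ (Prec* Θ a u × Prec* Θ v b)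
prec*-∷-edge⁻ uv ε = inj₁ ε
prec*-∷-edge⁻ uv (ac ◅ cb) with prec-∷⁻ ac | prec*-∷-edge⁻ uv cb
... | inj₁ ac-edge | rest with edge-unique uv ac-edge
...   | refl , refl = inj₂ (ε , [ id , proj₂ ] rest)
prec*-∷-edge⁻ uv (ac ◅ cb) | inj₂ ac′ | inj₁ cb′ = inj₁ (ac′ ◅ cb′)
prec*-∷-edge⁻ uv (ac ◅ cb) | inj₂ ac′ | inj₂ (cu , vb) = inj₂ (ac′ ◅ cu , vb)

prec*-∷-edge⁺ : ∀ {e Θ u v a b} → IsEdge e u v → Prec* Θ a b ⊎ (Prec* Θ a u × Prec* Θ v b) →
                Star (Prec (e ∷ Θ)) a b
prec*-∷-edge⁺ uv (inj₁ ab) = prec*-∷⁺ ab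
prec*-∷-edge⁺ (φ , uv) (inj₂ (au , vb)) = prec*-∷⁺ au ◅◅ (φ , here uv) ◅ prec*-∷⁺ vb

prec*-∷-nonEdge⁻ : ∀ {e Θ a b} → ¬ ∃₂ (IsEdge e) → Star (Prec (e ∷ Θ)) a b → Prec* Θ a b
prec*-∷-nonEdge⁻ noEdge =
  gmap id λ ab → [ (λ edge → ⊥-elim (noEdge (_ , _ , edge))) , id ] (prec-∷⁻ ab)

prec*? : ∀ Θ a b → Dec (Prec* Θ a b)
prec*? [] a b = map′ (λ { refl → ε }) (λ { ε → refl ; ((_ , ()) ◅ _) }) (a ≟ b)
prec*? (e ∷ Θ) a b with edge? e
... | yes (u , v , uv) =
  map′ (prec*-∷-edge⁺ uv) (prec*-∷-edge⁻ uv) (prec*? Θ a b ⊎-dec prec*? Θ a u ×-dec prec*? Θ v b)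
... | no noEdge = map′ prec*-∷⁺ (prec*-∷-nonEdge⁻ noEdge) (prec*? Θ a b)

TwinsBelow : Fm → Branch → Nom → Set
TwinsBelow φ0 Θ i = ∃₂ λ a b → a ≢ b × Prec* Θ a i × Prec* Θ b i × Twins φ0 Θ a b

ancestor-candidate : ∀ {Θ a i} → Prec* Θ a i → a ∈ i ∷ map nm Θ
ancestor-candidate ε = here refl
ancestor-candidate ((_ , a∈Θ) ◅ _) = there (∈-map⁺ nm a∈Θ)

twinsBelow? : ∀ φ0 Θ i → Dec (TwinsBelow φ0 Θ i)
twinsBelow? φ0 Θ i =
  map′ (λ any → let a , any′ = Any.satisfied any ; b , pair = Any.satisfied any′ in a , b , pair)
       (λ (a , b , pair@(_ , a≺*i , b≺*i , _)) →
          lose (ancestor-candidate a≺*i) (lose (ancestor-candidate b≺*i) pair))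
       (any? (λ a → any? (λ b → pair? a b) candidates) candidates)
  where
  candidates : List Nom
  candidates = i ∷ map nm Θ
  pair? : ∀ a b → Dec (a ≢ b × Prec* Θ a i × Prec* Θ b i × Twins φ0 Θ a b)
  pair? a b = ¬? (a ≟ b) ×-dec prec*? Θ a i ×-dec prec*? Θ b i ×-dec twins? φ0 Θ a b

¬twinsBelow⇒quasiUrfather : ∀ {φ0 Θ i} → ¬ TwinsBelow φ0 Θ i → QuasiUrfather φ0 Θ i
¬twinsBelow⇒quasiUrfather none a b a≢b a≺*i b≺*i a~b = none (a , b , a≢b , a≺*i , b≺*i , a~b)

quasiUrfather? : ∀ φ0 Θ i → Dec (QuasiUrfather φ0 Θ i)
quasiUrfather? φ0 Θ i =
  map′ ¬twinsBelow⇒quasiUrfather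
       (λ qu (a , b , a≢b , a≺*i , b≺*i , a~b) → qu a b a≢b a≺*i b≺*i a~b)
       (¬? (twinsBelow? φ0 Θ i))

quasiUrfather-ancestor : ∀ {φ0 Θ a i} → QuasiUrfather φ0 Θ i → Prec* Θ a i → QuasiUrfather φ0 Θ a
quasiUrfather-ancestor qu a≺*i b c b≢c b≺*a c≺*a = qu b c b≢c (b≺*a ◅◅ a≺*i) (c≺*a ◅◅ a≺*i)

_occursIn_ : Nom → Entry → Set
k occursIn e = k ≡ nm e ⊎ NomIn k (fm e)

someNomIn? : {S : Nom → Set} → Decidable S → ∀ φ → Dec (∃ λ k → S k × NomIn k φ)
someNomIn? S? (prop _) = no λ { (_ , _ , ()) }
someNomIn? S? (nom n) = map′ (λ s → n , s , in-nom) (λ { (_ , s , in-nom) → s }) (S? n)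
someNomIn? S? (neg φ) =
  map′ (λ (k , s , k∈φ) → k , s , in-neg k∈φ) (λ { (k , s , in-neg k∈φ) → k , s , k∈φ })
       (someNomIn? S? φ)
someNomIn? S? (conj φ ψ) =
  map′ [ (λ (k , s , k∈φ) → k , s , in-conjˡ k∈φ) , (λ (k , s , k∈ψ) → k , s , in-conjʳ k∈ψ) ]
       (λ { (k , s , in-conjˡ k∈φ) → inj₁ (k , s , k∈φ)
          ; (k , s , in-conjʳ k∈ψ) → inj₂ (k , s , k∈ψ) })
       (someNomIn? S? φ ⊎-dec someNomIn? S? ψ)
someNomIn? S? (dia φ) =
  map′ (λ (k , s , k∈φ) → k , s , in-dia k∈φ) (λ { (k , s , in-dia k∈φ) → k , s , k∈φ })
       (someNomIn? S? φ)
someNomIn? S? (at m φ) =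
  map′ [ (λ s → m , s , in-at) , (λ (k , s , k∈φ) → k , s , in-atᵗ k∈φ) ]
       (λ { (k , s , in-at) → inj₁ s ; (k , s , in-atᵗ k∈φ) → inj₂ (k , s , k∈φ) })
       (S? m ⊎-dec someNomIn? S? φ)

someOccursIn? : {S : Nom → Set} → Decidable S → ∀ e → Dec (∃ λ k → S k × k occursIn e)
someOccursIn? S? e =
  map′ [ (λ s → nm e , s , inj₁ refl) , (λ (k , s , k∈φ) → k , s , inj₂ k∈φ) ]
       (λ { (k , s , inj₁ refl) → inj₁ s ; (k , s , inj₂ k∈φ) → inj₂ (k , s , k∈φ) })
       (S? (nm e) ⊎-dec someNomIn? S? (fm e))

introNoLater-here : ∀ {e Θ j k} → j occursIn e → IntroNoLater (e ∷ Θ) j k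
introNoLater-here j∈e []      _ _    ()
introNoLater-here j∈e (_ ∷ _) _ refl _ = here j∈e

introNoLater-there : ∀ {e Θ j k} → ¬ k occursIn e → IntroNoLater Θ j k → IntroNoLater (e ∷ Θ) j k
introNoLater-there k∉e j≤k []      _ _    ()
introNoLater-there k∉e j≤k (_ ∷ _) _ refl (here k∈e)  = ⊥-elim (k∉e k∈e)
introNoLater-there k∉e j≤k (_ ∷ Δ) Γ refl (there k∈Δ) = there (j≤k Δ Γ refl k∈Δ)

earliest : {S : Nom → Set} → Decidable S → ∀ Θ → ∃ (λ k → S k × Occurs k Θ) →
           ∃ λ j → S j × Occurs j Θ × (∀ {k} → S k → IntroNoLater Θ j k)
earliest S? [] (_ , _ , ())
earliest S? (e ∷ Θ) witness with someOccursIn? S? e | witness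
... | yes (j , s , j∈e) | _ = j , s , here j∈e , λ _ → introNoLater-here j∈e
... | no noneInE | k , s , here k∈e = ⊥-elim (noneInE (k , s , k∈e))
... | no noneInE | k , s , there k∈Θ with earliest S? Θ (k , s , k∈Θ)
...   | j , sj , j∈Θ , first =
  j , sj , there j∈Θ , λ sk → introNoLater-there (λ k∈e → noneInE (_ , sk , k∈e)) (first sk)

UniqueParents : Branch → Set
UniqueParents Θ = ∀ {a b c} → Prec Θ a c → Prec Θ b c → a ≡ b

occurs-parent : ∀ {Θ a c} → Prec Θ a c → Occurs a Θ
occurs-parent (_ , ac) = Any.map (λ { refl → inj₁ refl }) ac

occurs-child : ∀ {Θ a c} → Prec Θ a c → Occurs c Θ
occurs-child (_ , ac) = Any.map (λ { refl → inj₂ (in-dia in-nom) }) ac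

occurs-ancestor : ∀ {Θ a i} → Occurs i Θ → Prec* Θ a i → Occurs a Θ
occurs-ancestor i∈Θ ε        = i∈Θ
occurs-ancestor _   (ac ◅ _) = occurs-parent ac

FreshEdges : Branch → List Entry → Set
FreshEdges Θ Δ = ∀ {a c} → Prec Δ a c → ¬ Occurs c Θ × (∀ {b} → Prec Δ b c → a ≡ b)

prec-++⁻ : ∀ Θ {Δ a c} → Prec (Θ ++ Δ) a c → Prec Θ a c ⊎ Prec Δ a c
prec-++⁻ Θ (φ , ac) with ∈-++⁻ Θ ac
... | inj₁ ac′ = inj₁ (φ , ac′)
... | inj₂ ac′ = inj₂ (φ , ac′)

uniqueParents-++ : ∀ {Θ Δ} → UniqueParents Θ → FreshEdges Θ Δ → UniqueParents (Θ ++ Δ)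
uniqueParents-++ {Θ} unique fresh ac bc with prec-++⁻ Θ ac | prec-++⁻ Θ bc
... | inj₁ ac′ | inj₁ bc′ = unique ac′ bc′
... | inj₁ ac′ | inj₂ bc′ = ⊥-elim (proj₁ (fresh bc′) (occurs-child ac′))
... | inj₂ ac′ | inj₁ bc′ = ⊥-elim (proj₁ (fresh ac′) (occurs-child bc′))
... | inj₂ ac′ | inj₂ bc′ = proj₂ (fresh ac′) bc′

freshEdges-ordinary : ∀ {Θ Δ} → All (λ e → tag e ≡ ord) Δ → FreshEdges Θ Δ
freshEdges-ordinary ordinary (_ , ac) with All.lookup ordinary ac
... | ()

freshEdges-dia : ∀ {Θ i j φ} → ¬ Occurs j Θ →
                 FreshEdges Θ (ent i (dia (nom j)) (acc φ) ∷ ent j φ ord ∷ [])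
freshEdges-dia j∉Θ (_ , here refl) = j∉Θ , λ { (_ , here refl) → refl ; (_ , there (here ())) }
freshEdges-dia j∉Θ (_ , there (here ()))

freshEdges-rule : ∀ {φ0 Θ alts} → App φ0 Θ alts → All (FreshEdges Θ) alts
freshEdges-rule (r-negneg _)      = freshEdges-ordinary (refl ∷ []) ∷ []
freshEdges-rule (r-conj _)        = freshEdges-ordinary (refl ∷ refl ∷ []) ∷ []
freshEdges-rule (r-negconj _)     =
  freshEdges-ordinary (refl ∷ []) ∷ freshEdges-ordinary (refl ∷ []) ∷ []
freshEdges-rule (r-dia _ _ _ j∉Θ) = freshEdges-dia j∉Θ ∷ []
freshEdges-rule (r-negdia _ _)    = freshEdges-ordinary (refl ∷ []) ∷ []
freshEdges-rule (r-at _)          = freshEdges-ordinary (refl ∷ []) ∷ []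
freshEdges-rule (r-negat _)       = freshEdges-ordinary (refl ∷ []) ∷ []
freshEdges-rule (r-id _ _)        = freshEdges-ordinary (refl ∷ []) ∷ []
freshEdges-rule (r-ref _)         = freshEdges-ordinary (refl ∷ []) ∷ []
freshEdges-rule (r-boxsym _ _)    = freshEdges-ordinary (refl ∷ []) ∷ []
freshEdges-rule (r-irr _)         = freshEdges-ordinary (refl ∷ []) ∷ []

uniqueParents : ∀ {r φ0 Θ} → TabBranch r φ0 Θ → UniqueParents Θ
uniqueParents (root _) (_ , here ()) _
uniqueParents (extend tb _ _ app Δ∈alts) =
  uniqueParents-++ (uniqueParents tb) (All.lookup (freshEdges-rule app) Δ∈alts)

ancestor-of-child : ∀ {Θ i j k} → UniqueParents Θ → Prec Θ i j → Prec* Θ k j → k ≡ j ⊎ Prec* Θ k i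
ancestor-of-child unique i≺j ε = inj₁ refl
ancestor-of-child unique i≺j (k≺l ◅ l≺*j) with ancestor-of-child unique i≺j l≺*j
... | inj₁ refl with unique k≺l i≺j
...   | refl = inj₂ ε
ancestor-of-child unique i≺j (k≺l ◅ l≺*j) | inj₂ l≺*i = inj₂ (k≺l ◅ l≺*i)

twin-of-child : ∀ {φ0 Θ i j} → UniqueParents Θ → QuasiUrfather φ0 Θ i → Prec Θ i j →
                TwinsBelow φ0 Θ j → ∃ λ k → Prec* Θ k i × Twins φ0 Θ j k
twin-of-child unique qu i≺j (a , b , a≢b , a≺*j , b≺*j , a~b)
  with ancestor-of-child unique i≺j a≺*j | ancestor-of-child unique i≺j b≺*j
... | inj₁ refl  | inj₁ refl  = ⊥-elim (a≢b refl)
... | inj₁ refl  | inj₂ b≺*i = b , b≺*i , a~b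
... | inj₂ a≺*i | inj₁ refl  = a , a≺*i , twins-sym a~b
... | inj₂ a≺*i | inj₂ b≺*i = ⊥-elim (qu a b a≢b a≺*i b≺*i a~b)

QuasiUrfatherTwin : Fm → Branch → Nom → Nom → Set
QuasiUrfatherTwin φ0 Θ j k = Twins φ0 Θ j k × QuasiUrfather φ0 Θ k

quasiUrfatherTwin-of-child : ∀ {φ0 Θ i j} → UniqueParents Θ → QuasiUrfather φ0 Θ i → Prec Θ i j →
                             ∃ λ k → QuasiUrfatherTwin φ0 Θ j k × Occurs k Θ
quasiUrfatherTwin-of-child {φ0} {Θ} {j = j} unique qu i≺j with twinsBelow? φ0 Θ j
... | no none = j , (twins-refl , ¬twinsBelow⇒quasiUrfather none) , occurs-child i≺j
... | yes twins with twin-of-child unique qu i≺j twins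
...   | k , k≺*i , j~k =
  k , (j~k , quasiUrfather-ancestor qu k≺*i) , occurs-ancestor (occurs-parent i≺j) k≺*i

inDomV-of-quasiUrfatherTwin : ∀ {φ0 Θ j} → Occurs j Θ →
                              ∃ (λ k → QuasiUrfatherTwin φ0 Θ j k × Occurs k Θ) → InDomV φ0 Θ j
inDomV-of-quasiUrfatherTwin {φ0} {Θ} {j} j∈Θ twin
  with earliest (λ k → twins? φ0 Θ j k ×-dec quasiUrfather? φ0 Θ k) Θ twin
... | v , (j~v , qv) , v∈Θ , first = j∈Θ , v , v∈Θ , j~v , qv , λ k _ j~k qk → first (j~k , qk)

lemma6 : ∀ {r φ0 Θ} → TabBranch r φ0 Θ → Saturated φ0 Θ →
           ∀ {i j} → QuasiUrfather φ0 Θ i → Prec Θ i j → InDomV φ0 Θ j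
lemma6 tb _ qu i≺j =
  inDomV-of-quasiUrfatherTwin (occurs-child i≺j)
                              (quasiUrfatherTwin-of-child (uniqueParents tb) qu i≺j)
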